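{- Let $\mathcal{H}$ be a hypergraph and let $D$ be a minimal dominating set of the co-bipartite incidence graph $B(\mathcal{H})$. Then either $D=\{x,y_e\}$ for some $x\in V(\mathcal{H})\cup\{v\}$ and $e\in\mathcal{E}(\mathcal{H})$, or $D$ is a minimal transversal of $\mathcal{H}$.
   Context: A hypergraph $\mathcal{H}$ is a pair $(V(\mathcal{H}),\mathcal{E}(\mathcal{H}))$ with $V(\mathcal{H})$ finite and $\mathcal{E}(\mathcal{H})\subseteq 2^{V(\mathcal{H})}\setminus\{\emptyset\}$; a transversal is a subset of $V(\mathcal{H})$ meeting every hyperedge, and it is minimal if it contains no other transversal as a proper subset. The co-bipartite incidence graph $B(\mathcal{H})$ has vertex set $V(\mathcal{H})\cup\{y_e\mid e\in\mathcal{E}(\mathcal{H})\}\cup\{v\}$ (new distinct vertices $y_e$ and $v$) and edge set consisting of: $xy_e$ for $x\in V(\mathcal{H})$, $e\in\mathcal{E}(\mathcal{H})$ with $x\in e$; $vx$ for all $x\in V(\mathcal{H})$; $xy$ for all distinct $x,y\in V(\mathcal{H})$; and $y_ey_{e'}$ for all distinct $e,e'\in\mathcal{E}(\mathcal{H})$. A dominating set of a graph is a vertex set $D$ such that every vertex is in $D$ or has a neighbour in $D$; it is minimal if it contains no other dominating set as a proper subset. -}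

module Defs where

open import Data.Nat using (ℕ; suc)
open import Data.Fin using (Fin)
open import Data.Fin.Subset using (Subset; _∈_; _∉_; Nonempty)
open import Data.Bool using (Bool; true; false)
open import Data.Product using (Σ; ∃; _×_; _,_)
open import Data.Sum using (_⊎_)
open import Data.Unit using (⊤)
open import Data.Empty using (⊥)
open import Relation.Nullary using (¬_)
open import Relation.Binary.PropositionalEquality using (_≡_; _≢_)
open import Function.Definitions using (Injective)

-- A hypergraph on vertex set Fin n with m hyperedges (edges indexed by Fin m).
-- Hyperedges are nonempty subsets, pairwise distinct (so the edge family is a set).
record Hypergraph : Set where
  field
    n        : ℕ
    m        : ℕ
    edge     : Fin m → Subset n
    nonempty : ∀ e → Nonempty (edge e)
    distinct : Injective _≡_ _≡_ edge
open Hypergraph public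

IsTransversal : (H : Hypergraph) → Subset (n H) → Set
IsTransversal H T = ∀ e → ∃ λ x → x ∈ T × x ∈ edge H e

_⊂ₛ_ : ∀ {k} → Subset k → Subset k → Set
A ⊂ₛ B = (∀ x → x ∈ A → x ∈ B) × ∃ λ x → x ∈ B × x ∉ A

IsMinimalTransversal : (H : Hypergraph) → Subset (n H) → Set
IsMinimalTransversal H T =
  IsTransversal H T × (∀ T' → T' ⊂ₛ T → ¬ IsTransversal H T')

-- Vertices of the co-bipartite incidence graph B(H):
-- vx x  (x ∈ V(H)),  ye e  (e ∈ E(H)),  vv  (the extra vertex v).
data BVertex (H : Hypergraph) : Set where
  vx : Fin (n H) → BVertex H
  ye : Fin (m H) → BVertex H
  vv : BVertex H

Adj : (H : Hypergraph) → BVertex H → BVertex H → Set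
Adj H (vx x) (vx y) = x ≢ y
Adj H (vx x) (ye e) = x ∈ edge H e
Adj H (vx x) vv     = ⊤
Adj H (ye e) (vx x) = x ∈ edge H e
Adj H (ye e) (ye f) = e ≢ f
Adj H (ye e) vv     = ⊥
Adj H vv     (vx x) = ⊤
Adj H vv     (ye e) = ⊥
Adj H vv     vv     = ⊥

VSet : Hypergraph → Set
VSet H = BVertex H → Bool

_∈ᵥ_ : ∀ {H} → BVertex H → VSet H → Set
w ∈ᵥ D = D w ≡ true

_⊂ᵥ_ : ∀ {H} → VSet H → VSet H → Set
D' ⊂ᵥ D = (∀ w → w ∈ᵥ D' → w ∈ᵥ D) × ∃ λ w → w ∈ᵥ D × ¬ (w ∈ᵥ D')

IsDominating : (H : Hypergraph) → VSet H → Set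
IsDominating H D = ∀ w → w ∈ᵥ D ⊎ ∃ λ u → u ∈ᵥ D × Adj H w u

IsMinimalDominating : (H : Hypergraph) → VSet H → Set
IsMinimalDominating H D =
  IsDominating H D × (∀ D' → D' ⊂ᵥ D → ¬ IsDominating H D')

IsPairForm : (H : Hypergraph) → VSet H → Set
IsPairForm H D =
  ∃ λ (x : BVertex H) → ((x ≡ vv) ⊎ ∃ (λ i → x ≡ vx i)) ×
  ∃ λ (e : Fin (m H)) →
    ∀ w → (w ∈ᵥ D → (w ≡ x ⊎ w ≡ ye e)) × ((w ≡ x ⊎ w ≡ ye e) → w ∈ᵥ D)

IsMinimalTransversalOfB : (H : Hypergraph) → VSet H → Set
IsMinimalTransversalOfB H D =
  Σ (Subset (n H)) λ T →
    (∀ w → (w ∈ᵥ D → ∃ λ i → w ≡ vx i × i ∈ T) × ((∃ λ i → w ≡ vx i × i ∈ T) → w ∈ᵥ D))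
    × IsMinimalTransversal H T

-- Every vertex of V(H) ∪ {v} dominates all of V(H) ∪ {v} except possibly
-- itself, and every y_e dominates all y_f.  So if a minimal dominating set D
-- contains some y_e, it also contains some x ∈ V(H) ∪ {v} (v itself or a
-- neighbour of v), and {x, y_e} ⊆ D is already dominating, hence equal to D.
-- Otherwise D ∩ V(H) meets every hyperedge, because each y_e is dominated from
-- V(H); conversely every transversal T of a nonempty edge set dominates B(H).
-- Minimality of D then excludes v from D and forces D ∩ V(H) to be a minimal
-- transversal.
module Submission where

open import Defs
open import Data.Nat using (_≥_)
open import Data.Fin using (Fin; fromℕ<)
open import Data.Fin.Properties using (any?) renaming (_≟_ to _≟ᶠ_)
open import Data.Fin.Subset using (Subset) renaming (_∈_ to _∈ₛ_)
open import Data.Bool using (true; false; _∨_) renaming (_≟_ to _≟ᵇ_)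
open import Data.Bool.Properties using (∨-zeroʳ)
open import Data.Vec using (lookup; tabulate)
open import Data.Vec.Properties using ([]=⇒lookup; lookup⇒[]=; lookup∘tabulate)
open import Data.Product using (∃; _×_; _,_; proj₁; proj₂)
open import Data.Sum using (_⊎_; inj₁; inj₂)
open import Data.Unit using (tt)
open import Data.Empty using (⊥-elim)
open import Function using (_∘_)
open import Relation.Nullary using (¬_; yes; no; does; Dec; contradiction)
open import Relation.Nullary.Decidable using (map′; dec-true)
open import Relation.Binary using (DecidableEquality)
open import Relation.Binary.PropositionalEquality using (_≡_; _≢_; refl; sym; cong; trans)

module _ {H : Hypergraph} where

  _⊆ᵥ_ : VSet H → VSet H → Set
  D' ⊆ᵥ D = ∀ w → w ∈ᵥ D' → w ∈ᵥ D

  ⊆-minimalDominating⇒⊇ : ∀ {D D'} → IsMinimalDominating H D → IsDominating H D' →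
    D' ⊆ᵥ D → D ⊆ᵥ D'
  ⊆-minimalDominating⇒⊇ {D' = D'} (_ , minimal) dom' D'⊆D w w∈D with D' w in eq
  ... | true  = refl
  ... | false = ⊥-elim (minimal D' (D'⊆D , w , w∈D , w∉D') dom')
    where
    w∉D' : ¬ w ∈ᵥ D'
    w∉D' w∈D' = contradiction (trans (sym eq) w∈D') λ ()

  IsHub : BVertex H → Set
  IsHub x = (x ≡ vv) ⊎ ∃ (λ i → x ≡ vx i)

  dominating⇒hub : ∀ {D} → IsDominating H D → ∃ λ x → x ∈ᵥ D × IsHub x
  dominating⇒hub dom with dom vv
  ... | inj₁ vv∈D = vv , vv∈D , inj₁ refl
  ... | inj₂ (vx i , vx∈D , _) = vx i , vx∈D , inj₂ (i , refl)

  vx-injective : ∀ {i j} → vx {H} i ≡ vx j → i ≡ j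
  vx-injective refl = refl

  ye-injective : ∀ {e f} → ye {H} e ≡ ye f → e ≡ f
  ye-injective refl = refl

  _≟ᵥ_ : DecidableEquality (BVertex H)
  vx i ≟ᵥ vx j = map′ (cong vx) vx-injective (i ≟ᶠ j)
  vx _ ≟ᵥ ye _ = no λ ()
  vx _ ≟ᵥ vv   = no λ ()
  ye _ ≟ᵥ vx _ = no λ ()
  ye e ≟ᵥ ye f = map′ (cong ye) ye-injective (e ≟ᶠ f)
  ye _ ≟ᵥ vv   = no λ ()
  vv   ≟ᵥ vx _ = no λ ()
  vv   ≟ᵥ ye _ = no λ ()
  vv   ≟ᵥ vv   = yes refl

  dominatedBy : ∀ {D u w} → u ∈ᵥ D → Dec (w ≡ u) → (w ≢ u → Adj H w u) →
    w ∈ᵥ D ⊎ ∃ λ u → u ∈ᵥ D × Adj H w u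
  dominatedBy u∈D (yes refl) _   = inj₁ u∈D
  dominatedBy u∈D (no w≢u)   adj = inj₂ (_ , u∈D , adj w≢u)

  ⁅_,_⁆ : BVertex H → BVertex H → VSet H
  ⁅ a , b ⁆ w = does (w ≟ᵥ a) ∨ does (w ≟ᵥ b)

  ∈-pair⁺ : ∀ {a b w} → w ≡ a ⊎ w ≡ b → w ∈ᵥ ⁅ a , b ⁆
  ∈-pair⁺ {a} {b} {w} (inj₁ w≡a) rewrite dec-true (w ≟ᵥ a) w≡a = refl
  ∈-pair⁺ {a} {b} {w} (inj₂ w≡b) rewrite dec-true (w ≟ᵥ b) w≡b = ∨-zeroʳ _

  ∈-pair⁻ : ∀ {a b w} → w ∈ᵥ ⁅ a , b ⁆ → w ≡ a ⊎ w ≡ b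
  ∈-pair⁻ {a} {b} {w} w∈ab with w ≟ᵥ a | w ≟ᵥ b | w∈ab
  ... | yes w≡a | _       | _  = inj₁ w≡a
  ... | no _    | yes w≡b | _  = inj₂ w≡b
  ... | no _    | no _    | ()

  hubPair-dominating : ∀ {x} e → IsHub x → IsDominating H ⁅ x , ye e ⁆
  hubPair-dominating {x} e hub = dom hub
    where
    x∈ : x ∈ᵥ ⁅ x , ye e ⁆
    x∈ = ∈-pair⁺ {x} {ye e} (inj₁ refl)

    ye∈ : ye e ∈ᵥ ⁅ x , ye e ⁆
    ye∈ = ∈-pair⁺ {x} {ye e} (inj₂ refl)

    dom : IsHub x → IsDominating H ⁅ x , ye e ⁆
    dom (inj₁ refl)       (vx j) = inj₂ (vv , x∈ , tt)
    dom (inj₂ (i , refl)) (vx j) = dominatedBy x∈ (vx j ≟ᵥ vx i) λ j≢i → j≢i ∘ cong vx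
    dom _                 (ye f) = dominatedBy ye∈ (ye f ≟ᵥ ye e) λ f≢e → f≢e ∘ cong ye
    dom (inj₁ refl)       vv     = inj₁ x∈
    dom (inj₂ (i , refl)) vv     = inj₂ (vx i , x∈ , tt)

  minimalDominating-⊇hubPair : ∀ {D x} e → IsMinimalDominating H D → IsHub x →
    x ∈ᵥ D → ye e ∈ᵥ D → IsPairForm H D
  minimalDominating-⊇hubPair {D} {x} e minD hub x∈D ye∈D =
    x , hub , e , λ w → (λ w∈D → ∈-pair⁻ (D⊆pair w w∈D)) , pair⊆D w
    where
    pair⊆D : ∀ w → w ≡ x ⊎ w ≡ ye e → w ∈ᵥ D
    pair⊆D _ (inj₁ refl) = x∈D
    pair⊆D _ (inj₂ refl) = ye∈D

    D⊆pair : D ⊆ᵥ ⁅ x , ye e ⁆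
    D⊆pair = ⊆-minimalDominating⇒⊇ minD (hubPair-dominating e hub)
               (λ w w∈pair → pair⊆D w (∈-pair⁻ w∈pair))

  trace : VSet H → Subset (n H)
  trace D = tabulate (λ i → D (vx i))

  embed : Subset (n H) → VSet H
  embed T (vx i) = lookup T i
  embed T (ye _) = false
  embed T vv     = false

  ∈-trace⁺ : ∀ {D i} → vx i ∈ᵥ D → i ∈ₛ trace D
  ∈-trace⁺ {D} {i} vx∈D = lookup⇒[]= i (trace D) (trans (lookup∘tabulate (λ j → D (vx j)) i) vx∈D)

  ∈-trace⁻ : ∀ {D i} → i ∈ₛ trace D → vx i ∈ᵥ D
  ∈-trace⁻ {D} {i} i∈T = trans (sym (lookup∘tabulate (λ j → D (vx j)) i)) ([]=⇒lookup i∈T)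

  embed-dominating : ∀ {T} → Fin (m H) → IsTransversal H T → IsDominating H (embed T)
  embed-dominating {T} e₀ transversal = dom
    where
    i₀ : Fin (n H)
    i₀ = proj₁ (transversal e₀)

    i₀∈T : i₀ ∈ₛ T
    i₀∈T = proj₁ (proj₂ (transversal e₀))

    dom : IsDominating H (embed T)
    dom (vx j) = dominatedBy ([]=⇒lookup i₀∈T) (vx j ≟ᵥ vx i₀) λ j≢i₀ → j≢i₀ ∘ cong vx
    dom (ye f) = let (i , i∈T , i∈f) = transversal f in inj₂ (vx i , []=⇒lookup i∈T , i∈f)
    dom vv     = inj₂ (vx i₀ , []=⇒lookup i₀∈T , tt)

  trace-transversal : ∀ {D} → IsDominating H D → ¬ (∃ λ e → ye e ∈ᵥ D) →
    IsTransversal H (trace D)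
  trace-transversal {D} dom noYe e with dom (ye e)
  ... | inj₁ ye∈D                = ⊥-elim (noYe (e , ye∈D))
  ... | inj₂ (vx i , vx∈D , i∈e) = i , ∈-trace⁺ {D} vx∈D , i∈e
  ... | inj₂ (ye f , ye∈D , _)   = ⊥-elim (noYe (f , ye∈D))

  embed-⊆ : ∀ {D T} → (∀ i → i ∈ₛ T → i ∈ₛ trace D) → embed T ⊆ᵥ D
  embed-⊆ {D} {T} T⊆D (vx i) i∈T = ∈-trace⁻ {D} (T⊆D i (lookup⇒[]= i T i∈T))

  minimalDominating⇒minimalTransversal : ∀ {D} → Fin (m H) → IsMinimalDominating H D →
    ¬ (∃ λ e → ye e ∈ᵥ D) → IsMinimalTransversalOfB H D
  minimalDominating⇒minimalTransversal {D} e₀ minD@(dom , _) noYe =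
    trace D , (λ w → D⊆trace w , trace⊆D w) , transversal , minimal
    where
    transversal : IsTransversal H (trace D)
    transversal = trace-transversal dom noYe

    D⊆embed : ∀ {T} → IsTransversal H T → (∀ i → i ∈ₛ T → i ∈ₛ trace D) → D ⊆ᵥ embed T
    D⊆embed transversalT T⊆D =
      ⊆-minimalDominating⇒⊇ minD (embed-dominating e₀ transversalT) (embed-⊆ {D} T⊆D)

    -- v ∉ D because D ⊆ embed (trace D), which omits v.
    D⊆trace : ∀ w → w ∈ᵥ D → ∃ λ i → w ≡ vx i × i ∈ₛ trace D
    D⊆trace (vx i) vx∈D = i , refl , ∈-trace⁺ {D} vx∈D
    D⊆trace (ye e) ye∈D = ⊥-elim (noYe (e , ye∈D))
    D⊆trace vv     vv∈D = contradiction (D⊆embed transversal (λ _ i∈T → i∈T) vv vv∈D) λ ()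

    trace⊆D : ∀ w → (∃ λ i → w ≡ vx i × i ∈ₛ trace D) → w ∈ᵥ D
    trace⊆D _ (i , refl , i∈T) = ∈-trace⁻ {D} i∈T

    minimal : ∀ T' → T' ⊂ₛ trace D → ¬ IsTransversal H T'
    minimal T' (T'⊆T , i , i∈T , i∉T') transversal' =
      i∉T' (lookup⇒[]= i T' (D⊆embed transversal' T'⊆T (vx i) (∈-trace⁻ {D} i∈T)))

lemma3p3 : (H : Hypergraph) → m H ≥ 1 → (D : VSet H) → IsMinimalDominating H D →
    IsPairForm H D ⊎ IsMinimalTransversalOfB H D
lemma3p3 H m≥1 D minD@(dom , _) with any? (λ e → D (ye e) ≟ᵇ true)
... | yes (e , ye∈D) =
  let (x , x∈D , hub) = dominating⇒hub dom
  in  inj₁ (minimalDominating-⊇hubPair e minD hub x∈D ye∈D)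
... | no noYe = inj₂ (minimalDominating⇒minimalTransversal (fromℕ< m≥1) minD noYe)
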